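{- For every positive integer $n$, \[ \chi_{2K_2}(P_n) \geq \sqrt{2\left\lceil \frac{n-1}{3} \right\rceil + \frac14} + \frac12 . \]
   Context: All graphs are finite and simple. $P_n$ denotes the path on $n$ vertices and $2K_2$ the graph consisting of two disjoint edges. For a fixed bipartite graph $H$, a proper vertex coloring of a graph $G$ is called an $H$-avoiding coloring if for any two color classes, the subgraph of $G$ induced by their union contains no induced subgraph isomorphic to $H$. $\chi_H(G)$ denotes the minimum number of colors in an $H$-avoiding coloring of $G$. -}

module Defs where

open import Data.Nat using (ℕ; zero; suc; _+_; _*_; _∸_; _≤_; _/_)
open import Data.Fin using (Fin; toℕ)
open import Data.Product using (Σ; _×_; _,_)
open import Data.Sum using (_⊎_)
open import Relation.Binary.PropositionalEquality using (_≡_; _≢_) renaming (sym to sym′)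
open import Relation.Nullary using (¬_)
open import Function.Definitions using (Injective)
open import Function.Bundles using (_⇔_)
open import Level using (0ℓ)

record Graph (n : ℕ) : Set₁ where
  field
    Adj     : Fin n → Fin n → Set
    sym     : ∀ {u v} → Adj u v → Adj v u
    irrefl  : ∀ {v} → ¬ Adj v v
open Graph public

PathAdj : ∀ {n} → Fin n → Fin n → Set
PathAdj i j = (toℕ j ≡ suc (toℕ i)) ⊎ (toℕ i ≡ suc (toℕ j))

Path : (n : ℕ) → Graph n
Path n = record { Adj = PathAdj ; sym = sy ; irrefl = irr }
  where
  open import Data.Sum using (inj₁; inj₂)
  open import Data.Nat.Properties using (1+n≢n)
  sy : ∀ {u v} → PathAdj u v → PathAdj v u
  sy (inj₁ p) = inj₂ p
  sy (inj₂ p) = inj₁ p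
  irr : ∀ {v} → ¬ PathAdj v v
  irr (inj₁ p) = 1+n≢n (sym′ p)
  irr (inj₂ p) = 1+n≢n (sym′ p)

open import Data.Fin using (zero; suc)
open import Data.Empty using (⊥)
open import Data.Unit using (⊤)

2K2Adj : Fin 4 → Fin 4 → Set
2K2Adj zero (suc zero) = ⊤
2K2Adj (suc zero) zero = ⊤
2K2Adj (suc (suc zero)) (suc (suc (suc zero))) = ⊤
2K2Adj (suc (suc (suc zero))) (suc (suc zero)) = ⊤
2K2Adj _ _ = ⊥

2K2 : Graph 4
2K2 = record { Adj = 2K2Adj ; sym = sy ; irrefl = irr }
  where
  sy : ∀ {u v} → 2K2Adj u v → 2K2Adj v u
  sy {zero} {suc zero} _ = _
  sy {suc zero} {zero} _ = _
  sy {suc (suc zero)} {suc (suc (suc zero))} _ = _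
  sy {suc (suc (suc zero))} {suc (suc zero)} _ = _
  irr : ∀ {v} → ¬ 2K2Adj v v
  irr {zero} ()
  irr {suc zero} ()
  irr {suc (suc zero)} ()
  irr {suc (suc (suc zero))} ()

InducedCopyIn : ∀ {h n} → (H : Graph h) → (G : Graph n) → (Fin n → Set) → Set
InducedCopyIn {h} {n} H G S =
  Σ (Fin h → Fin n) λ f →
    Injective _≡_ _≡_ f
    × (∀ x → S (f x))
    × (∀ x y → Adj H x y ⇔ Adj G (f x) (f y))

Proper : ∀ {n k} → Graph n → (Fin n → Fin k) → Set
Proper G c = ∀ u v → Adj G u v → c u ≢ c v

Avoiding : ∀ {h n k} → Graph h → Graph n → (Fin n → Fin k) → Set
Avoiding H G c =
  Proper G c ×
  (∀ a b → a ≢ b → ¬ InducedCopyIn H G (λ v → (c v ≡ a) ⊎ (c v ≡ b)))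

⌈_/3⌉ : ℕ → ℕ
⌈ m /3⌉ = (m + 2) / 3

{-# OPTIONS --safe #-}
-- The edges {3t, 3t+1} of P_n, for t < ⌈(n-1)/3⌉, are pairwise at distance at
-- least 2, so any two of them induce a 2K2. In a 2K2-avoiding colouring two such
-- edges therefore never carry the same pair of colours, since together they would
-- lie in the union of two colour classes. So the colouring gives ⌈(n-1)/3⌉
-- distinct 2-element subsets of the k colours, whence 2⌈(n-1)/3⌉ ≤ k(k-1).
module Submission where

open import Defs hiding (sym)
open import Data.Nat using (ℕ; suc; _+_; _*_; _∸_; _≤_; _<_; s≤s⁻¹; >-nonZero⁻¹)
open import Data.Nat.Properties
  using (module ≤-Reasoning; ≤-trans; ≤-reflexive; n≤1+n; n<1+n; <-trans; <-irrefl;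
         <-asym; <-cmp; 1+n≰n; +-comm; +-suc; *-comm; *-suc; *-monoʳ-≤)
open import Data.Nat.DivMod using (m/n*n≤m)
open import Data.Fin using (Fin; toℕ; fromℕ<; combine; punchOut; remQuot)
open import Data.Fin.Patterns using (0F; 1F; 2F; 3F)
open import Data.Fin.Properties
  using (nonZeroIndex; toℕ<n; toℕ-fromℕ<; toℕ-injective; combine-injective; punchOut-injective;
         injective⇒≤; *↔×)
open import Data.Product using (_×_; _,_; proj₁; proj₂)
open import Data.Sum using (_⊎_; inj₁; inj₂)
open import Data.Empty using (⊥; ⊥-elim)
open import Data.Unit using (⊤; tt)
open import Function using (_∘_)
open import Function.Bundles using (_⇔_; mk⇔; Injection)
open import Function.Properties.Inverse using (↔⇒↣)
open import Relation.Binary.Definitions using (tri<; tri≈; tri>)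
open import Relation.Binary.PropositionalEquality
  using (_≡_; _≢_; refl; sym; trans; cong; subst)
open import Relation.Nullary using (¬_)

module _ {n} (G : Graph n) where

  Apart : Fin n → Fin n → Set
  Apart x y = x ≢ y × ¬ Adj G x y

  EdgesApart : Fin n → Fin n → Fin n → Fin n → Set
  EdgesApart u₁ v₁ u₂ v₂ = Apart u₁ u₂ × Apart u₁ v₂ × Apart v₁ u₂ × Apart v₁ v₂

  Apart-sym : ∀ {x y} → Apart x y → Apart y x
  Apart-sym (x≢y , ¬xy) = (λ y≡x → x≢y (sym y≡x)) , (λ yx → ¬xy (Graph.sym G yx))

  twoEdges : Fin n → Fin n → Fin n → Fin n → Fin 4 → Fin n
  twoEdges u₁ v₁ u₂ v₂ 0F = u₁
  twoEdges u₁ v₁ u₂ v₂ 1F = v₁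
  twoEdges u₁ v₁ u₂ v₂ 2F = u₂
  twoEdges u₁ v₁ u₂ v₂ 3F = v₂

  apartEdges⇒induced-2K2 : ∀ {u₁ v₁ u₂ v₂} → Adj G u₁ v₁ → Adj G u₂ v₂ →
                           EdgesApart u₁ v₁ u₂ v₂ → (S : Fin n → Set) →
                           S u₁ → S v₁ → S u₂ → S v₂ → InducedCopyIn 2K2 G S
  apartEdges⇒induced-2K2 {u₁} {v₁} {u₂} {v₂} e₁ e₂ (u₁u₂ , u₁v₂ , v₁u₂ , v₁v₂) S s₁ s₂ s₃ s₄ =
    f , (λ {i} {j} → proj₁ (faithful i j)) , inS , (λ i j → proj₂ (faithful i j))
    where
    f : Fin 4 → Fin n
    f = twoEdges u₁ v₁ u₂ v₂

    inS : ∀ i → S (f i)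
    inS 0F = s₁
    inS 1F = s₂
    inS 2F = s₃
    inS 3F = s₄

    loop : ∀ {i : Fin 4} {v} → (v ≡ v → i ≡ i) × (⊥ ⇔ Adj G v v)
    loop = (λ _ → refl) , mk⇔ (λ ()) (Graph.irrefl G)

    edge : ∀ {i j : Fin 4} {a b} → Adj G a b → (a ≡ b → i ≡ j) × (⊤ ⇔ Adj G a b)
    edge ab = (λ { refl → ⊥-elim (Graph.irrefl G ab) }) , mk⇔ (λ _ → ab) (λ _ → tt)

    nonEdge : ∀ {i j : Fin 4} {a b} → Apart a b → (a ≡ b → i ≡ j) × (⊥ ⇔ Adj G a b)
    nonEdge (a≢b , ¬ab) = (λ a≡b → ⊥-elim (a≢b a≡b)) , mk⇔ (λ ()) ¬ab

    faithful : ∀ i j → (f i ≡ f j → i ≡ j) × (2K2Adj i j ⇔ Adj G (f i) (f j))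
    faithful 0F 0F = loop
    faithful 0F 1F = edge e₁
    faithful 0F 2F = nonEdge u₁u₂
    faithful 0F 3F = nonEdge u₁v₂
    faithful 1F 0F = edge (Graph.sym G e₁)
    faithful 1F 1F = loop
    faithful 1F 2F = nonEdge v₁u₂
    faithful 1F 3F = nonEdge v₁v₂
    faithful 2F 0F = nonEdge (Apart-sym u₁u₂)
    faithful 2F 1F = nonEdge (Apart-sym v₁u₂)
    faithful 2F 2F = loop
    faithful 2F 3F = edge e₂
    faithful 3F 0F = nonEdge (Apart-sym u₁v₂)
    faithful 3F 1F = nonEdge (Apart-sym v₁v₂)
    faithful 3F 2F = edge (Graph.sym G e₂)
    faithful 3F 3F = loop

SameUnorderedPair : {A : Set} → A → A → A → A → Set
SameUnorderedPair a b a′ b′ = (a ≡ a′ × b ≡ b′) ⊎ (a ≡ b′ × b ≡ a′)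

SameUnorderedPair-sym : ∀ {A : Set} {a b a′ b′ : A} →
                        SameUnorderedPair a b a′ b′ → SameUnorderedPair a′ b′ a b
SameUnorderedPair-sym (inj₁ (p , q)) = inj₁ (sym p , sym q)
SameUnorderedPair-sym (inj₂ (p , q)) = inj₂ (sym q , sym p)

2K2-avoiding⇒colourPairs-differ :
  ∀ {n k} (G : Graph n) {c : Fin n → Fin k} → Avoiding 2K2 G c →
  ∀ {u₁ v₁ u₂ v₂} → Adj G u₁ v₁ → Adj G u₂ v₂ → EdgesApart G u₁ v₁ u₂ v₂ →
  ¬ SameUnorderedPair (c u₁) (c v₁) (c u₂) (c v₂)
2K2-avoiding⇒colourPairs-differ G {c} (proper , no2K2) {u₁} {v₁} e₁ e₂ apart same =
  no2K2 (c u₁) (c v₁) (proper u₁ v₁ e₁) (copy same)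
  where
  copy : SameUnorderedPair (c u₁) (c v₁) _ _ →
         InducedCopyIn 2K2 G (λ v → (c v ≡ c u₁) ⊎ (c v ≡ c v₁))
  copy (inj₁ (p , q)) =
    apartEdges⇒induced-2K2 G e₁ e₂ apart _ (inj₁ refl) (inj₂ refl) (inj₁ (sym p)) (inj₂ (sym q))
  copy (inj₂ (p , q)) =
    apartEdges⇒induced-2K2 G e₁ e₂ apart _ (inj₁ refl) (inj₂ refl) (inj₂ (sym q)) (inj₁ (sym p))

distinctPair : ∀ {k} {a b : Fin k} → a ≢ b → Fin (k * (k ∸ 1))
distinctPair {suc k} {a} a≢b = combine a (punchOut a≢b)

distinctPair-injective : ∀ {k} {a b a′ b′ : Fin k} (p : a ≢ b) (p′ : a′ ≢ b′) →
                         distinctPair p ≡ distinctPair p′ → a ≡ a′ × b ≡ b′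
distinctPair-injective {suc k} {a} {a′ = a′} p p′ eq
  with combine-injective a (punchOut p) a′ (punchOut p′) eq
... | refl , q = refl , punchOut-injective p p′ q

-- Each unordered pair {p t, q t} is counted in both orientations, so the bound
-- comes out as 2m ≤ k(k-1) without binomial coefficients.
distinctUnorderedPairs⇒2m≤k[k-1] :
  ∀ {m k} (p q : Fin m → Fin k) → (∀ t → p t ≢ q t) →
  (∀ t u → SameUnorderedPair (p t) (q t) (p u) (q u) → t ≡ u) →
  2 * m ≤ k * (k ∸ 1)
distinctUnorderedPairs⇒2m≤k[k-1] {m} {k} p q p≢q distinct =
  injective⇒≤ {f = oriented ∘ remQuot m} (Injection.injective (↔⇒↣ *↔×) ∘ oriented-injective)
  where
  oriented : Fin 2 × Fin m → Fin (k * (k ∸ 1))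
  oriented (0F , t) = distinctPair (p≢q t)
  oriented (1F , t) = distinctPair (p≢q t ∘ sym)

  oriented-injective : ∀ {x y} → oriented x ≡ oriented y → x ≡ y
  oriented-injective {0F , t} {0F , u} eq with distinctPair-injective _ _ eq
  ... | pt≡pu , qt≡qu = cong (0F ,_) (distinct t u (inj₁ (pt≡pu , qt≡qu)))
  oriented-injective {0F , t} {1F , u} eq with distinctPair-injective _ _ eq
  ... | pt≡qu , qt≡pu with distinct t u (inj₂ (pt≡qu , qt≡pu))
  ... | refl = ⊥-elim (p≢q t pt≡qu)
  oriented-injective {1F , t} {0F , u} eq with distinctPair-injective _ _ eq
  ... | qt≡pu , pt≡qu with distinct t u (inj₂ (pt≡qu , qt≡pu))
  ... | refl = ⊥-elim (p≢q t pt≡qu)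
  oriented-injective {1F , t} {1F , u} eq with distinctPair-injective _ _ eq
  ... | qt≡qu , pt≡pu = cong (1F ,_) (distinct t u (inj₁ (pt≡pu , qt≡qu)))

module _ {n : ℕ} where

  far⇒apart : ∀ {i j : Fin n} → 2 + toℕ i ≤ toℕ j → Apart (Path n) i j
  far⇒apart {i} {j} 2+i≤j = i≢j , ¬adj
    where
    i<j : toℕ i < toℕ j
    i<j = ≤-trans (n≤1+n _) 2+i≤j

    i≢j : i ≢ j
    i≢j refl = <-irrefl refl i<j

    ¬adj : ¬ PathAdj i j
    ¬adj (inj₁ j≡1+i) = 1+n≰n (subst (2 + toℕ i ≤_) j≡1+i 2+i≤j)
    ¬adj (inj₂ i≡1+j) = <-asym i<j (≤-reflexive (sym i≡1+j))

  successorEdges-apart : ∀ {a a′ b b′ : Fin n} → toℕ a′ ≡ suc (toℕ a) → toℕ b′ ≡ suc (toℕ b) →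
                         3 + toℕ a ≤ toℕ b → EdgesApart (Path n) a a′ b b′
  successorEdges-apart {a} {a′} {b} {b′} a′≡1+a b′≡1+b 3+a≤b =
    far⇒apart 2+a≤b , far⇒apart (≤-trans 2+a≤b b≤b′) ,
    far⇒apart 2+a′≤b , far⇒apart (≤-trans 2+a′≤b b≤b′)
    where
    2+a≤b : 2 + toℕ a ≤ toℕ b
    2+a≤b = ≤-trans (n≤1+n _) 3+a≤b

    2+a′≤b : 2 + toℕ a′ ≤ toℕ b
    2+a′≤b = subst (λ x → 2 + x ≤ toℕ b) (sym a′≡1+a) 3+a≤b

    b≤b′ : toℕ b ≤ toℕ b′
    b≤b′ = subst (toℕ b ≤_) (sym b′≡1+b) (n≤1+n _)

module InducedMatching {n m : ℕ} (3m≤n+1 : 3 * m ≤ n + 1) where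

  1+3t<n : (t : Fin m) → suc (3 * toℕ t) < n
  1+3t<n t = s≤s⁻¹ (begin
    3 + 3 * toℕ t    ≡⟨ *-suc 3 (toℕ t) ⟨
    3 * suc (toℕ t)  ≤⟨ *-monoʳ-≤ 3 (toℕ<n t) ⟩
    3 * m            ≤⟨ 3m≤n+1 ⟩
    n + 1            ≡⟨ +-comm n 1 ⟩
    suc n            ∎)
    where open ≤-Reasoning

  left right : Fin m → Fin n
  left t = fromℕ< (<-trans (n<1+n _) (1+3t<n t))
  right t = fromℕ< (1+3t<n t)

  toℕ-left : ∀ t → toℕ (left t) ≡ 3 * toℕ t
  toℕ-left t = toℕ-fromℕ< _

  toℕ-right : ∀ t → toℕ (right t) ≡ suc (toℕ (left t))
  toℕ-right t = trans (toℕ-fromℕ< _) (cong suc (sym (toℕ-left t)))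

  edge : ∀ t → Adj (Path n) (left t) (right t)
  edge t = inj₁ (toℕ-right t)

  left-spacing : ∀ {t u} → toℕ t < toℕ u → 3 + toℕ (left t) ≤ toℕ (left u)
  left-spacing {t} {u} t<u = begin
    3 + toℕ (left t)  ≡⟨ cong (3 +_) (toℕ-left t) ⟩
    3 + 3 * toℕ t     ≡⟨ *-suc 3 (toℕ t) ⟨
    3 * suc (toℕ t)   ≤⟨ *-monoʳ-≤ 3 t<u ⟩
    3 * toℕ u         ≡⟨ toℕ-left u ⟨
    toℕ (left u)      ∎
    where open ≤-Reasoning

  edges-apart : ∀ {t u} → toℕ t < toℕ u →
                EdgesApart (Path n) (left t) (right t) (left u) (right u)
  edges-apart {t} {u} t<u =
    successorEdges-apart (toℕ-right t) (toℕ-right u) (left-spacing t<u)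

2K2-avoiding-path⇒2m≤k[k-1] : ∀ {n k} m → 3 * m ≤ n + 1 → (c : Fin n → Fin k) →
                              Avoiding 2K2 (Path n) c → 2 * m ≤ k * (k ∸ 1)
2K2-avoiding-path⇒2m≤k[k-1] m 3m≤n+1 c avoiding@(proper , _) =
  distinctUnorderedPairs⇒2m≤k[k-1] (c ∘ left) (c ∘ right) (λ t → proper _ _ (edge t)) distinct
  where
  open InducedMatching {m = m} 3m≤n+1

  differ : ∀ {t u} → toℕ t < toℕ u →
           ¬ SameUnorderedPair (c (left t)) (c (right t)) (c (left u)) (c (right u))
  differ {t} {u} t<u =
    2K2-avoiding⇒colourPairs-differ (Path _) avoiding (edge t) (edge u) (edges-apart t<u)

  distinct : ∀ t u → SameUnorderedPair (c (left t)) (c (right t)) (c (left u)) (c (right u)) →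
             t ≡ u
  distinct t u same with <-cmp (toℕ t) (toℕ u)
  ... | tri< t<u _ _ = ⊥-elim (differ t<u same)
  ... | tri≈ _ t≡u _ = toℕ-injective t≡u
  ... | tri> _ _ u<t = ⊥-elim (differ u<t (SameUnorderedPair-sym same))

3*⌈m/3⌉≤m+2 : ∀ m → 3 * ⌈ m /3⌉ ≤ m + 2
3*⌈m/3⌉≤m+2 m = subst (_≤ m + 2) (*-comm ⌈ m /3⌉ 3) (m/n*n≤m (m + 2) 3)

corollary5p1 : (n : ℕ) → 1 ≤ n → (k : ℕ) → (c : Fin n → Fin k) →
               Avoiding 2K2 (Path n) c →
               (1 ≤ k) × (2 * ⌈ n ∸ 1 /3⌉ ≤ k * (k ∸ 1))
corollary5p1 (suc n) _ k c avoiding =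
  >-nonZero⁻¹ k {{nonZeroIndex (c 0F)}} ,
  2K2-avoiding-path⇒2m≤k[k-1] ⌈ n /3⌉ (subst (3 * ⌈ n /3⌉ ≤_) (+-suc n 1) (3*⌈m/3⌉≤m+2 n))
    c avoiding
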